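{- Every graph in the minor-obstruction set of $\mathcal G_2=\{G:{\sf sbn}(G)\le 2\}$ is $2$-connected.
   Context: A strict bramble of $G$ is a collection of vertex sets each inducing a connected subgraph, pairwise sharing a vertex; its order is the minimum size of a vertex set meeting all members; ${\sf sbn}(G)$ is the maximum order of a strict bramble. The minor-obstruction set of $\mathcal G_2$ is the set of minor-minimal graphs not in $\mathcal G_2$. A graph is $2$-connected if it has at least 3 vertices and no separating set of size less than 2. -}

module Defs where

open import Data.Nat using (ℕ; _≤_; _<_)
open import Data.Bool using (Bool; true; false)
open import Data.Fin using (Fin)
open import Data.Fin.Subset using (Subset; _∈_; _∉_; ∁; ∣_∣; Nonempty)
open import Data.Product using (Σ; ∃; _×_; _,_)
open import Relation.Binary.PropositionalEquality using (_≡_)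
open import Relation.Nullary using (¬_)

record Graph : Set where
  field
    n      : ℕ
    adj    : Fin n → Fin n → Bool
    sym    : ∀ i j → adj i j ≡ adj j i
    irrefl : ∀ i → adj i i ≡ false

open Graph public

Adj : (G : Graph) → Fin (n G) → Fin (n G) → Set
Adj G i j = adj G i j ≡ true

data Reach (G : Graph) (S : Subset (n G)) (u : Fin (n G)) : Fin (n G) → Set where
  here : u ∈ S → Reach G S u u
  step : ∀ {w v} → Reach G S u w → Adj G w v → v ∈ S → Reach G S u v

Connected : (G : Graph) → Subset (n G) → Set
Connected G S = Nonempty S × (∀ u v → u ∈ S → v ∈ S → Reach G S u v)

Meets : {m : ℕ} → Subset m → Subset m → Set
Meets X S = ∃ λ v → v ∈ X × v ∈ S

StrictBramble : (G : Graph) → (Subset (n G) → Bool) → Set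
StrictBramble G B =
  (∀ S → B S ≡ true → Connected G S) × (∀ S T → B S ≡ true → B T ≡ true → Meets S T)

Order≤ : (G : Graph) → (Subset (n G) → Bool) → ℕ → Set
Order≤ G B k = Σ (Subset (n G)) λ X → ∣ X ∣ ≤ k × (∀ S → B S ≡ true → Meets X S)

Sbn≤ : Graph → ℕ → Set
Sbn≤ G k = ∀ (B : Subset (n G) → Bool) → StrictBramble G B → Order≤ G B k

InG2 : Graph → Set
InG2 G = Sbn≤ G 2

-- H is a minor of G (minor model: disjoint connected branch sets, edges of H
-- realised by edges of G between the corresponding branch sets).
record _≼_ (H G : Graph) : Set where
  field
    branch    : Fin (n H) → Subset (n G)
    connected : ∀ x → Connected G (branch x)
    disjoint  : ∀ x y → ¬ (x ≡ y) → ∀ v → v ∈ branch x → v ∉ branch y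
    edges     : ∀ x y → Adj H x y →
                ∃ λ u → ∃ λ v → u ∈ branch x × v ∈ branch y × Adj G u v

Obstruction : Graph → Set
Obstruction G = ¬ InG2 G × (∀ H → H ≼ G → ¬ InG2 H → G ≼ H)

TwoConnected : Graph → Set
TwoConnected G = 3 ≤ n G × (∀ (X : Subset (n G)) → ∣ X ∣ < 2 → Connected G (∁ X))

module Submission where

-- Let G be an obstruction and suppose a set X of at most one vertex separates u from v in G − X;
-- let C be the component of u in G − X and D the rest of G − X. Every edge leaving C or D ends in X.
-- By minimality sbn(G − u) ≤ 2 and sbn(G − v) ≤ 2. Take a strict bramble B of G. If some member
-- lies inside C, all members meet C and hence leave D; otherwise all members leave C. Let Z be a
-- side that every member leaves and w ∈ {u, v} the vertex in it. Removing Z from every member keeps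
-- members connected and pairwise intersecting, because a path between two vertices outside Z that
-- dips into Z leaves and re-enters through the single vertex of X. These traces avoid w, so they form
-- a strict bramble of G − w; a hitting set of size at most 2 for it hits B. Hence sbn(G) ≤ 2, which
-- is a contradiction; and G has at least 3 vertices since smaller graphs trivially have sbn ≤ 2.

open import Defs hiding (sym)
open import Data.Nat using (ℕ; zero; suc; _≤_; _<_; z≤n; s≤s)
open import Data.Nat.Properties using (≤-refl; ≤-reflexive; ≤-trans; <-≤-trans; ≤-pred; n<1+n; <⇒≱; ≰⇒>)
open import Data.Bool using (Bool; true; false)
open import Data.Bool.Properties using () renaming (_≟_ to _≟ᴮ_)
open import Data.Fin using (Fin; punchIn; punchOut)
open import Data.Fin.Properties using (any?; ¬∀⟶∃¬; pigeonhole; <⇒≢; punchIn-injective; punchIn-punchOut)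
  renaming (_≟_ to _≟ᶠ_)
open import Data.Fin.Subset using (Subset; Side; inside; outside; _∈_; _∉_; _⊆_; ∁; ∣_∣; Nonempty; ⊤; ⁅_⁆; _─_; _-_)
open import Data.Fin.Subset.Properties
  using (_∈?_; _⊆?_; nonempty?; anySubset?; ∈⊤; ∣⊤∣≡n; p⊆q⇒∣p∣≤∣q∣; p─q⊆p; x∈p∧x∉q⇒x∈p─q;
         x∈p∧x≢y⇒x∈p-y; x∈p⇒∣p-x∣<∣p∣; x∈∁p⇒x∉p; x∉p⇒x∈∁p; x∉∁p⇒x∈p; x∈⁅x⁆; x∈⁅y⁆⇒x≡y; ∣⁅x⁆∣≡1)
open import Data.Vec using (Vec; _∷_; there; lookup; tabulate; insertAt; removeAt)
open import Data.Vec.Properties using (≡-dec; lookup∘tabulate; []=⇒lookup; lookup⇒[]=; insertAt-punchIn; insertAt-removeAt)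
open import Data.Product using (∃; _×_; _,_; proj₁; proj₂)
open import Data.Sum using (_⊎_; inj₁; inj₂; [_,_]′)
open import Function using (_∘_; id)
open import Relation.Nullary using (¬_; Dec; yes; no; does; contradiction)
open import Relation.Nullary.Decidable using (_×-dec_; _→-dec_; dec-true; decidable-stable)
open import Relation.Binary.PropositionalEquality using (_≡_; _≢_; refl; sym; trans; cong; subst; subst₂; module ≡-Reasoning)

dec-true⁻ : ∀ {ℓ} {P : Set ℓ} (P? : Dec P) → does P? ≡ true → P
dec-true⁻ (yes p) _ = p

Subsingleton : ∀ {k} → Subset k → Set
Subsingleton X = ∀ {x y} → x ∈ X → y ∈ X → x ≡ y

∣p∣<2⇒subsingleton : ∀ {k} (X : Subset k) → ∣ X ∣ < 2 → Subsingleton X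
∣p∣<2⇒subsingleton X ∣X∣<2 {x} {y} x∈X y∈X with x ≟ᶠ y
... | yes x≡y = x≡y
... | no x≢y = contradiction (≤-trans (s≤s ∣X-x∣≥1) (x∈p⇒∣p-x∣<∣p∣ x∈X)) (<⇒≱ ∣X∣<2)
  where
    ∣X-x∣≥1 : 1 ≤ ∣ X - x ∣
    ∣X-x∣≥1 = subst (_≤ ∣ X - x ∣) (∣⁅x⁆∣≡1 y)
      (p⊆q⇒∣p∣≤∣q∣ λ z∈⁅y⁆ → subst (_∈ X - x) (sym (x∈⁅y⁆⇒x≡y y z∈⁅y⁆)) (x∈p∧x≢y⇒x∈p-y y∈X (x≢y ∘ sym)))

∣p∣<n⇒∁-nonempty : ∀ {k} {X : Subset k} → ∣ X ∣ < k → Nonempty (∁ X)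
∣p∣<n⇒∁-nonempty {k} {X} ∣X∣<k = decidable-stable (nonempty? (∁ X)) λ ∁X-empty →
  <⇒≱ ∣X∣<k (subst (_≤ ∣ X ∣) (∣⊤∣≡n k) (p⊆q⇒∣p∣≤∣q∣ {p = ⊤} λ {x} _ → x∉∁p⇒x∈p λ x∈∁X → ∁X-empty (x , x∈∁X)))

x∈p─q⇒x∉q : ∀ {k} {p q : Subset k} {x} → x ∈ p ─ q → x ∉ q
x∈p─q⇒x∉q {p = _ ∷ _} {outside ∷ _} (there x∈p─q) (there x∈q) = x∈p─q⇒x∉q x∈p─q x∈q
x∈p─q⇒x∉q {p = _ ∷ _} {inside  ∷ _} (there x∈p─q) (there x∈q) = x∈p─q⇒x∉q x∈p─q x∈q

p⊈q⇒∃∉ : ∀ {k} {p q : Subset k} → ¬ p ⊆ q → ∃ λ x → x ∈ p × x ∉ q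
p⊈q⇒∃∉ {k} {p} {q} p⊈q with ¬∀⟶∃¬ k (λ x → x ∈ p → x ∈ q) (λ x → x ∈? p →-dec x ∈? q) (λ ∀x → p⊈q (∀x _))
... | x , ¬[x∈p→x∈q] with x ∈? p
...   | yes x∈p = x , x∈p , λ x∈q → ¬[x∈p→x∈q] λ _ → x∈q
...   | no x∉p  = contradiction (λ x∈p → contradiction x∈p x∉p) ¬[x∈p→x∈q]

∈-tabulate⁺ : ∀ {k} (f : Fin k → Bool) {x} → f x ≡ true → x ∈ tabulate f
∈-tabulate⁺ f {x} fx≡true = lookup⇒[]= x (tabulate f) (trans (lookup∘tabulate f x) fx≡true)

∈-tabulate⁻ : ∀ {k} (f : Fin k → Bool) {x} → x ∈ tabulate f → f x ≡ true
∈-tabulate⁻ f {x} x∈ = trans (sym (lookup∘tabulate f x)) ([]=⇒lookup x∈)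

lookup-removeAt : ∀ {k} {A : Set} (xs : Vec A (suc k)) w x → lookup (removeAt xs w) x ≡ lookup xs (punchIn w x)
lookup-removeAt xs w x = begin
  lookup (removeAt xs w) x                                    ≡⟨ insertAt-punchIn (removeAt xs w) w (lookup xs w) x ⟨
  lookup (insertAt (removeAt xs w) w (lookup xs w)) (punchIn w x) ≡⟨ cong (λ ys → lookup ys (punchIn w x)) (insertAt-removeAt xs w) ⟩
  lookup xs (punchIn w x)                                     ∎
  where open ≡-Reasoning

∈-removeAt⁺ : ∀ {k} {P : Subset (suc k)} {w x} → punchIn w x ∈ P → x ∈ removeAt P w
∈-removeAt⁺ {P = P} {w} {x} x∈P = lookup⇒[]= x _ (trans (lookup-removeAt P w x) ([]=⇒lookup x∈P))

∈-removeAt⁻ : ∀ {k} {P : Subset (suc k)} {w x} → x ∈ removeAt P w → punchIn w x ∈ P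
∈-removeAt⁻ {P = P} {w} {x} x∈ = lookup⇒[]= _ P (trans (sym (lookup-removeAt P w x)) ([]=⇒lookup x∈))

∈-insertAt⁺ : ∀ {k} {X : Subset k} {w x} (s : Side) → x ∈ X → punchIn w x ∈ insertAt X w s
∈-insertAt⁺ {X = X} {w} {x} s x∈X = lookup⇒[]= _ _ (trans (insertAt-punchIn X w s x) ([]=⇒lookup x∈X))

∣insertAt-outside∣ : ∀ {k} (X : Subset k) w → ∣ insertAt X w outside ∣ ≡ ∣ X ∣
∣insertAt-outside∣ X             Fin.zero    = refl
∣insertAt-outside∣ (inside ∷ X)  (Fin.suc w) = cong suc (∣insertAt-outside∣ X w)
∣insertAt-outside∣ (outside ∷ X) (Fin.suc w) = ∣insertAt-outside∣ X w

image : ∀ {a b} → (Subset a → Subset b) → (Subset a → Bool) → Subset b → Bool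
image f B T = does (anySubset? λ S → (B S ≟ᴮ true) ×-dec ≡-dec _≟ᴮ_ (f S) T)

image⁺ : ∀ {a b} {f : Subset a → Subset b} {B S} → B S ≡ true → image f B (f S) ≡ true
image⁺ {S = S} S∈B = dec-true (anySubset? _) (S , S∈B , refl)

image⁻ : ∀ {a b} {f : Subset a → Subset b} {B T} → image f B T ≡ true → ∃ λ S → B S ≡ true × f S ≡ T
image⁻ T∈ = dec-true⁻ (anySubset? _) T∈

module _ {G H : Graph} {B : Subset (n G) → Bool} (f : Subset (n G) → Subset (n H)) where

  strictBramble-image : (∀ S → B S ≡ true → Connected H (f S)) →
                        (∀ S T → B S ≡ true → B T ≡ true → Meets (f S) (f T)) →
                        StrictBramble H (image f B)
  strictBramble-image connected meets =
      (λ T T∈ → connected-image (image⁻ T∈))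
    , (λ T U T∈ U∈ → meets-image (image⁻ T∈) (image⁻ U∈))
    where
      connected-image : ∀ {T} → (∃ λ S → B S ≡ true × f S ≡ T) → Connected H T
      connected-image (S , S∈B , refl) = connected S S∈B
      meets-image : ∀ {T U} → (∃ λ S → B S ≡ true × f S ≡ T) → (∃ λ S → B S ≡ true × f S ≡ U) → Meets T U
      meets-image (S , S∈B , refl) (S′ , S′∈B , refl) = meets S S′ S∈B S′∈B

  order≤-image : ∀ {k} (g : Subset (n H) → Subset (n G)) → (∀ X → ∣ g X ∣ ≤ ∣ X ∣) →
                 (∀ {X S} → Meets X (f S) → Meets (g X) S) →
                 Order≤ H (image f B) k → Order≤ G B k
  order≤-image g shrinks pull (X , ∣X∣≤k , covers) =
    g X , ≤-trans (shrinks X) ∣X∣≤k , λ S S∈B → pull (covers (f S) (image⁺ {f = f} {B} S∈B))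

module _ (G : Graph) where

  adj-sym : ∀ {p q} → Adj G p q → Adj G q p
  adj-sym {p} {q} p~q = trans (Graph.sym G q p) p~q

  reach-start : ∀ {S u v} → Reach G S u v → u ∈ S
  reach-start (here u∈S)   = u∈S
  reach-start (step r _ _) = reach-start r

  reach-end : ∀ {S u v} → Reach G S u v → v ∈ S
  reach-end (here v∈S)     = v∈S
  reach-end (step _ _ v∈S) = v∈S

  reach-mono : ∀ {S T u v} → S ⊆ T → Reach G S u v → Reach G T u v
  reach-mono S⊆T (here u∈S)       = here (S⊆T u∈S)
  reach-mono S⊆T (step r w~v v∈S) = step (reach-mono S⊆T r) w~v (S⊆T v∈S)

  reach-cons : ∀ {S u w v} → u ∈ S → Adj G u w → Reach G S w v → Reach G S u v
  reach-cons u∈S u~w (here w∈S)       = step (here u∈S) u~w w∈S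
  reach-cons u∈S u~w (step r x~v v∈S) = step (reach-cons u∈S u~w r) x~v v∈S

  reach-uncons : ∀ {S u v} → Reach G S u v → u ≡ v ⊎ ∃ λ w → Adj G u w × Reach G (S - u) w v
  reach-uncons (here _) = inj₁ refl
  reach-uncons {u = u} (step {v = v} r x~v v∈S) with u ≟ᶠ v
  ... | yes u≡v = inj₁ u≡v
  ... | no u≢v with reach-uncons r
  ...   | inj₁ refl            = inj₂ (v , x~v , here (x∈p∧x≢y⇒x∈p-y v∈S (u≢v ∘ sym)))
  ...   | inj₂ (w , u~w , r′)  = inj₂ (w , u~w , step r′ x~v (x∈p∧x≢y⇒x∈p-y v∈S (u≢v ∘ sym)))

  reach? : ∀ S u v → Dec (Reach G S u v)
  reach? S = bounded (suc ∣ S ∣) S (n<1+n _)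
    where
      bounded : ∀ k S → ∣ S ∣ < k → ∀ u v → Dec (Reach G S u v)
      bounded (suc k) S ∣S∣<k+1 u v with u ∈? S | u ≟ᶠ v
      ... | no u∉S  | _        = no (u∉S ∘ reach-start)
      ... | yes u∈S | yes refl = yes (here u∈S)
      ... | yes u∈S | no u≢v
        with any? (λ w → (adj G u w ≟ᴮ true) ×-dec bounded k (S - u) (<-≤-trans (x∈p⇒∣p-x∣<∣p∣ u∈S) (≤-pred ∣S∣<k+1)) w v)
      ...   | yes (w , u~w , r) = yes (reach-cons u∈S u~w (reach-mono (p─q⊆p S _) r))
      ...   | no ¬first-step    = no λ r → [ u≢v , ¬first-step ]′ (reach-uncons r)

  component : Subset (n G) → Fin (n G) → Subset (n G)
  component Y u = tabulate λ v → does (reach? Y u v)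

  ∈-component⁺ : ∀ {Y u v} → Reach G Y u v → v ∈ component Y u
  ∈-component⁺ {Y} {u} {v} r = ∈-tabulate⁺ _ (dec-true (reach? Y u v) r)

  ∈-component⁻ : ∀ {Y u v} → v ∈ component Y u → Reach G Y u v
  ∈-component⁻ {Y} {u} {v} v∈C = dec-true⁻ (reach? Y u v) (∈-tabulate⁻ _ v∈C)

  Guarded : Subset (n G) → Subset (n G) → Set
  Guarded X Z = ∀ {p q} → p ∈ Z → Adj G p q → q ∉ Z → q ∈ X

  component-guarded : ∀ X u → Guarded X (component (∁ X) u)
  component-guarded X u {q = q} p∈C p~q q∉C with q ∈? ∁ X
  ... | yes q∈∁X = contradiction (∈-component⁺ {∁ X} {u} (step (∈-component⁻ p∈C) p~q q∈∁X)) q∉C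
  ... | no q∉∁X  = x∉∁p⇒x∈p q∉∁X

  remainder-guarded : ∀ X u → Guarded X (∁ X ─ component (∁ X) u)
  remainder-guarded X u {q = q} p∈D p~q q∉D with q ∈? ∁ X | q ∈? component (∁ X) u
  ... | no q∉∁X  | _       = x∉∁p⇒x∈p q∉∁X
  ... | yes q∈∁X | no q∉C  = contradiction (x∈p∧x∉q⇒x∈p─q q∈∁X q∉C) q∉D
  ... | yes q∈∁X | yes q∈C = contradiction
          (∈-component⁺ {∁ X} {u} (step (∈-component⁻ q∈C) (adj-sym p~q) (p─q⊆p _ _ p∈D))) (x∈p─q⇒x∉q p∈D)

  sbn≤-trivial : ∀ {k} → n G ≤ k → Sbn≤ G k
  sbn≤-trivial n≤k B (connected , _) =
    ⊤ , subst (_≤ _) (sym (∣⊤∣≡n _)) n≤k , λ S S∈B → let (v , v∈S) = proj₁ (connected S S∈B) in v , ∈⊤ , v∈S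

  module _ {X Z : Subset (n G)} (X-subsingleton : Subsingleton X) (guarded : Guarded X Z) where

    -- A path that enters Z must have passed through the unique vertex of X just before.
    reach-avoiding : ∀ {S a b} → Reach G S a b → a ∉ Z →
                     Reach G (S ─ Z) a b ⊎ (b ∈ Z × ∃ λ x → x ∈ X × Reach G (S ─ Z) a x)
    reach-avoiding (here a∈S) a∉Z = inj₁ (here (x∈p∧x∉q⇒x∈p─q a∈S a∉Z))
    reach-avoiding {S} (step {w} {b} r w~b b∈S) a∉Z with reach-avoiding r a∉Z | b ∈? Z
    ... | inj₁ r′ | no b∉Z  = inj₁ (step r′ w~b (x∈p∧x∉q⇒x∈p─q b∈S b∉Z))
    ... | inj₁ r′ | yes b∈Z = inj₂ (b∈Z , w , guarded b∈Z (adj-sym w~b) (x∈p─q⇒x∉q (reach-end r′)) , r′)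
    ... | inj₂ (_ , x , x∈X , r′) | yes b∈Z = inj₂ (b∈Z , x , x∈X , r′)
    ... | inj₂ (w∈Z , x , x∈X , r′) | no b∉Z =
          inj₁ (subst (Reach G (S ─ Z) _) (X-subsingleton x∈X (guarded w∈Z w~b b∉Z)) r′)

    connected-─ : ∀ {S} → Connected G S → Meets S (∁ Z) → Connected G (S ─ Z)
    connected-─ {S} (_ , reach) (a , a∈S , a∈∁Z) = (a , x∈p∧x∉q⇒x∈p─q a∈S (x∈∁p⇒x∉p a∈∁Z)) , reach-─
      where
        reach-─ : ∀ u v → u ∈ S ─ Z → v ∈ S ─ Z → Reach G (S ─ Z) u v
        reach-─ u v u∈ v∈ with reach-avoiding (reach u v (p─q⊆p _ _ u∈) (p─q⊆p _ _ v∈)) (x∈p─q⇒x∉q u∈)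
        ... | inj₁ r            = r
        ... | inj₂ (v∈Z , _)   = contradiction v∈Z (x∈p─q⇒x∉q v∈)

    meets-X-─ : ∀ {S z} → Connected G S → Meets S (∁ Z) → z ∈ S → z ∈ Z → Meets X (S ─ Z)
    meets-X-─ {z = z} (_ , reach) (a , a∈S , a∈∁Z) z∈S z∈Z with reach-avoiding (reach a z a∈S z∈S) (x∈∁p⇒x∉p a∈∁Z)
    ... | inj₁ r                  = contradiction z∈Z (x∈p─q⇒x∉q (reach-end r))
    ... | inj₂ (_ , x , x∈X , r)  = x , x∈X , reach-end r

    meets-─ : ∀ {S T} → Connected G S → Connected G T → Meets S (∁ Z) → Meets T (∁ Z) →
              Meets S T → Meets (S ─ Z) (T ─ Z)
    meets-─ S-conn T-conn S-out T-out (z , z∈S , z∈T) with z ∈? Z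
    ... | no z∉Z = z , x∈p∧x∉q⇒x∈p─q z∈S z∉Z , x∈p∧x∉q⇒x∈p─q z∈T z∉Z
    ... | yes z∈Z with meets-X-─ S-conn S-out z∈S z∈Z | meets-X-─ T-conn T-out z∈T z∈Z
    ...   | x , x∈X , x∈S─Z | x′ , x′∈X , x′∈T─Z = x , x∈S─Z , subst (_∈ _) (X-subsingleton x′∈X x∈X) x′∈T─Z

    strictBramble-─ : ∀ {B} → StrictBramble G B → (∀ S → B S ≡ true → Meets S (∁ Z)) →
                      StrictBramble G (image (_─ Z) B)
    strictBramble-─ {B} (connected , meets) out = strictBramble-image {G} {G} {B} (_─ Z)
      (λ S S∈B → connected-─ (connected S S∈B) (out S S∈B))
      (λ S T S∈B T∈B → meets-─ (connected S S∈B) (connected T T∈B) (out S S∈B) (out T T∈B) (meets S T S∈B T∈B))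

¬≼-fewer-vertices : ∀ {G H} → n H < n G → ¬ G ≼ H
¬≼-fewer-vertices H<G model with pigeonhole H<G (λ x → proj₁ (proj₁ (connected x)))
  where open _≼_ model
... | i , j , i<j , same = disjoint i j (<⇒≢ i<j) _ (proj₂ (proj₁ (connected i)))
                             (subst (_∈ branch j) (sym same) (proj₂ (proj₁ (connected j))))
  where open _≼_ model

¬InG2⇒3≤n : ∀ G → ¬ InG2 G → 3 ≤ n G
¬InG2⇒3≤n G ∉G2 = ≰⇒> (∉G2 ∘ sbn≤-trivial G)

module Deletion (m : ℕ) (A : Fin (suc m) → Fin (suc m) → Bool)
                (A-sym : ∀ i j → A i j ≡ A j i) (A-irrefl : ∀ i → A i i ≡ false) where

  G : Graph
  G = record { n = suc m ; adj = A ; sym = A-sym ; irrefl = A-irrefl }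

  deleteVertex : Fin (suc m) → Graph
  deleteVertex w = record
    { n = m ; adj = λ x y → A (punchIn w x) (punchIn w y) ; sym = λ _ _ → A-sym _ _ ; irrefl = λ _ → A-irrefl _ }

  module _ {w : Fin (suc m)} {P : Subset (suc m)} (w∉P : w ∉ P) where

    w≢member : ∀ {v} → v ∈ P → w ≢ v
    w≢member v∈P refl = w∉P v∈P

    punchOut-∈-removeAt : ∀ {v} (v∈P : v ∈ P) → punchOut (w≢member v∈P) ∈ removeAt P w
    punchOut-∈-removeAt v∈P = ∈-removeAt⁺ (subst (_∈ P) (sym (punchIn-punchOut (w≢member v∈P))) v∈P)

    reach-removeAt : ∀ {a b} → Reach G P a b → ∀ {a′ b′} → punchIn w a′ ≡ a → punchIn w b′ ≡ b →
                     Reach (deleteVertex w) (removeAt P w) a′ b′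
    reach-removeAt (here a∈P) {a′} {b′} a′↦a b′↦b with punchIn-injective w a′ b′ (trans a′↦a (sym b′↦b))
    ... | refl = here (∈-removeAt⁺ (subst (_∈ P) (sym a′↦a) a∈P))
    reach-removeAt (step r c~b b∈P) a′↦a b′↦b =
      step (reach-removeAt r a′↦a (punchIn-punchOut (w≢member c∈P)))
           (subst₂ (λ p q → A p q ≡ true) (sym (punchIn-punchOut (w≢member c∈P))) (sym b′↦b) c~b)
           (∈-removeAt⁺ (subst (_∈ P) (sym b′↦b) b∈P))
      where c∈P = reach-end G r

    connected-removeAt : Connected G P → Connected (deleteVertex w) (removeAt P w)
    connected-removeAt ((z , z∈P) , reach) =
      (_ , punchOut-∈-removeAt z∈P) ,
      λ u v u∈ v∈ → reach-removeAt (reach _ _ (∈-removeAt⁻ u∈) (∈-removeAt⁻ v∈)) refl refl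

    meets-removeAt : ∀ {Q} → Meets P Q → Meets (removeAt P w) (removeAt Q w)
    meets-removeAt (z , z∈P , z∈Q) =
      _ , punchOut-∈-removeAt z∈P , ∈-removeAt⁺ (subst (_∈ _) (sym (punchIn-punchOut (w≢member z∈P))) z∈Q)

  deleteVertex-≼ : ∀ w → deleteVertex w ≼ G
  deleteVertex-≼ w = record
    { branch    = λ x → ⁅ punchIn w x ⁆
    ; connected = λ x → (_ , x∈⁅x⁆ _) , λ u v u∈ v∈ → singleton-reach u∈ v∈
    ; disjoint  = λ x y x≢y v v∈x v∈y →
                    x≢y (punchIn-injective w x y (trans (sym (x∈⁅y⁆⇒x≡y _ v∈x)) (x∈⁅y⁆⇒x≡y _ v∈y)))
    ; edges     = λ x y x~y → _ , _ , x∈⁅x⁆ _ , x∈⁅x⁆ _ , x~y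
    }
    where
      singleton-reach : ∀ {x u v} → u ∈ ⁅ x ⁆ → v ∈ ⁅ x ⁆ → Reach G ⁅ x ⁆ u v
      singleton-reach {x} u∈ v∈ with x∈⁅y⁆⇒x≡y x u∈ | x∈⁅y⁆⇒x≡y x v∈
      ... | refl | refl = here u∈

  order≤-avoiding : ∀ {B k w} → StrictBramble G B → (∀ S → B S ≡ true → w ∉ S) →
                    Sbn≤ (deleteVertex w) k → Order≤ G B k
  order≤-avoiding {B} {w = w} (connected , meets) avoids sbn≤k =
    order≤-image {G} {deleteVertex w} {B} (λ S → removeAt S w) (λ X → insertAt X w outside)
      (λ X → ≤-reflexive (∣insertAt-outside∣ X w))
      (λ (x , x∈X , x∈) → punchIn w x , ∈-insertAt⁺ outside x∈X , ∈-removeAt⁻ x∈)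
      (sbn≤k _ (strictBramble-image {G} {deleteVertex w} {B} (λ S → removeAt S w)
        (λ S S∈B → connected-removeAt (avoids S S∈B) (connected S S∈B))
        (λ S T S∈B T∈B → meets-removeAt (avoids S S∈B) (meets S T S∈B T∈B))))

  order≤-guarded : ∀ {B k X Z w} → Subsingleton X → Guarded G X Z → w ∈ Z → StrictBramble G B →
                   (∀ S → B S ≡ true → Meets S (∁ Z)) → Sbn≤ (deleteVertex w) k → Order≤ G B k
  order≤-guarded {B} {Z = Z} {w} X-sub guarded w∈Z sb out sbn≤k =
    order≤-image {G} {G} {B} (_─ Z) id (λ _ → ≤-refl) (λ (x , x∈X , x∈) → x , x∈X , p─q⊆p _ _ x∈)
      (order≤-avoiding (strictBramble-─ G X-sub guarded sb out) (λ T T∈ → avoids (image⁻ {f = _─ Z} {B} T∈)) sbn≤k)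
    where
      avoids : ∀ {T} → (∃ λ S → B S ≡ true × S ─ Z ≡ T) → w ∉ T
      avoids (S , _ , refl) w∈S─Z = x∈p─q⇒x∉q w∈S─Z w∈Z

  sbn≤-separated : ∀ {k X u v} → Subsingleton X → u ∈ ∁ X → v ∈ ∁ X → ¬ Reach G (∁ X) u v →
                   Sbn≤ (deleteVertex u) k → Sbn≤ (deleteVertex v) k → Sbn≤ G k
  sbn≤-separated {X = X} {u} {v} X-sub u∈ v∈ u↛v sbn-u sbn-v B sb@(_ , meets)
    with anySubset? (λ S → (B S ≟ᴮ true) ×-dec (S ⊆? component G (∁ X) u))
  ... | yes (S₀ , S₀∈B , S₀⊆C) =
        order≤-guarded X-sub (remainder-guarded G X u) v∈D sb out-of-D sbn-v
    where
      C = component G (∁ X) u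
      v∈D = x∈p∧x∉q⇒x∈p─q v∈ (u↛v ∘ ∈-component⁻ G)
      out-of-D : ∀ S → B S ≡ true → Meets S (∁ (∁ X ─ C))
      out-of-D S S∈B = let (z , z∈S , z∈S₀) = meets S S₀ S∈B S₀∈B in
        z , z∈S , x∉p⇒x∈∁p λ z∈D → x∈p─q⇒x∉q z∈D (S₀⊆C z∈S₀)
  ... | no no-member-in-C =
        order≤-guarded X-sub (component-guarded G X u) (∈-component⁺ G (here u∈)) sb out-of-C sbn-u
    where
      out-of-C : ∀ S → B S ≡ true → Meets S (∁ (component G (∁ X) u))
      out-of-C S S∈B = let (z , z∈S , z∉C) = p⊈q⇒∃∉ λ S⊆C → no-member-in-C (S , S∈B , S⊆C) in
        z , z∈S , x∉p⇒x∈∁p z∉C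

  -- Minimality only gives ¬ ¬ InG2 for the deletions (membership in 𝒢₂ is not decidable),
  -- which suffices since reachability is decidable.
  obstruction-reach : Obstruction G → ∀ {X u v} → Subsingleton X → u ∈ ∁ X → v ∈ ∁ X → Reach G (∁ X) u v
  obstruction-reach (∉G2 , minimal) X-sub u∈ v∈ = decidable-stable (reach? G _ _ _) λ u↛v →
    ¬¬deletion _ λ sbn-u → ¬¬deletion _ λ sbn-v → ∉G2 (sbn≤-separated X-sub u∈ v∈ u↛v sbn-u sbn-v)
    where
      ¬¬deletion : ∀ w → ¬ ¬ InG2 (deleteVertex w)
      ¬¬deletion w ∉G2-w = ¬≼-fewer-vertices (n<1+n m) (minimal _ (deleteVertex-≼ w) ∉G2-w)

mainTheorem5 : ∀ (G : Graph) → Obstruction G → TwoConnected G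
mainTheorem5 G@record { n = zero } (∉G2 , _) = contradiction (¬InG2⇒3≤n G ∉G2) λ ()
mainTheorem5 G@record { n = suc m ; adj = A ; sym = A-sym ; irrefl = A-irrefl } obstruction@(∉G2 , _) =
  3≤n , λ X ∣X∣<2 →
      ∣p∣<n⇒∁-nonempty (<-≤-trans ∣X∣<2 (≤-trans (s≤s (s≤s z≤n)) 3≤n))
    , λ u v u∈ v∈ → Deletion.obstruction-reach m A A-sym A-irrefl obstruction (∣p∣<2⇒subsingleton X ∣X∣<2) u∈ v∈
  where 3≤n = ¬InG2⇒3≤n G ∉G2
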